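{- Let $n\geq 1$ and $k$ be integers. Then $$\frac{\mathcal{C}(n,k)}{n!}=\sum_{\substack{V\subseteq\{1,\dots,n\}\\ 1\in V,\ \sum_{v\in V}v=k}}\ \prod_{v\in V}\frac1v\prod_{v\in\{1,\dots,n\}\setminus V}\left(1-\frac1v\right).$$
   Context: For a permutation $\sigma=a_1\cdots a_n$ of $\{1,\dots,n\}$, position $j$ is a record position if $a_i<a_j$ for all $i<j$. $\mathcal{C}(n,k)$ denotes the number of permutations of $\{1,\dots,n\}$ whose record positions sum to $k$. -}

module Defs where

open import Data.Bool using (Bool; true; false; if_then_else_)
open import Data.Nat as ℕ using (ℕ; zero; suc)
open import Data.Nat.Properties using (_!≢0)

open import Data.Integer as ℤ using (ℤ; +_)
open import Data.Fin as Fin using (Fin; toℕ)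
open import Data.Fin.Properties using (all?)
open import Data.Fin.Subset using (Subset)
open import Data.Vec as Vec using (Vec; []; _∷_; lookup; toList)
open import Data.List as List using (List; []; _∷_; length; filter; concatMap; map)
open import Data.Nat.ListAction using (sum)
open import Data.List.Relation.Unary.AllPairs using (AllPairs)
import Data.List.Relation.Unary.AllPairs as AllPairs
open import Data.Rational as ℚ using (ℚ; _/_; 1ℚ; 0ℚ)
open import Relation.Nullary using (Dec; yes; no; ¬_; _×-dec_; _→-dec_)
open import Relation.Nullary.Decidable using (¬?)
open import Relation.Binary.PropositionalEquality using (_≡_; _≢_)

-- A word is a vector a : Vec (Fin n) n, where the Fin value m encodes the
-- letter m+1 ∈ {1,…,n}; position j : Fin n encodes the position toℕ j + 1.
-- A word is a permutation iff its letters are pairwise distinct.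

words : (n m : ℕ) → List (Vec (Fin n) m)
words n zero    = [] ∷ []
words n (suc m) = concatMap (λ x → map (x ∷_) (words n m)) (List.allFin n)

IsPerm : {n : ℕ} → Vec (Fin n) n → Set
IsPerm a = AllPairs _≢_ (toList a)

isPerm? : {n : ℕ} (a : Vec (Fin n) n) → Dec (IsPerm a)
isPerm? a = AllPairs.allPairs? (λ x y → ¬? (x Fin.≟ y)) (toList a)

IsRecord : {n : ℕ} → Vec (Fin n) n → Fin n → Set
IsRecord a j = ∀ i → i Fin.< j → lookup a i Fin.< lookup a j

isRecord? : {n : ℕ} (a : Vec (Fin n) n) (j : Fin n) → Dec (IsRecord a j)
isRecord? a j = all? (λ i → (i Fin.<? j) →-dec (lookup a i Fin.<? lookup a j))

recordSum : {n : ℕ} → Vec (Fin n) n → ℕ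
recordSum {n} a =
  sum (map (λ j → if Relation.Nullary.does (isRecord? a j) then suc (toℕ j) else 0)
           (List.allFin n))

𝒞 : ℕ → ℤ → ℕ
𝒞 n k = length (filter (λ a → isPerm? a ×-dec ((+ recordSum a) ℤ.≟ k)) (words n n))

-- Subsets V ⊆ {1,…,n}: V : Subset n, index i : Fin n encodes v = toℕ i + 1.

subsets : (n : ℕ) → List (Subset n)
subsets zero    = [] ∷ []
subsets (suc n) = concatMap (λ b → map (b ∷_) (subsets n)) (true ∷ false ∷ [])

elemSum : {n : ℕ} → Subset n → ℕ
elemSum {n} V = sum (map (λ i → if lookup V i then suc (toℕ i) else 0) (List.allFin n))

OneIn : {n : ℕ} → Subset n → Set
OneIn {zero}  V = Data.Empty.⊥ where import Data.Empty
OneIn {suc n} V = lookup V Fin.zero ≡ true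

oneIn? : {n : ℕ} (V : Subset n) → Dec (OneIn V)
oneIn? {zero}  V = no (λ ())
oneIn? {suc n} V = lookup V Fin.zero Data.Bool.≟ true where import Data.Bool

weight : {n : ℕ} → Subset n → ℚ
weight {n} V =
  List.foldr ℚ._*_ 1ℚ
    (map (λ i → if lookup V i then (+ 1 / suc (toℕ i)) else (1ℚ ℚ.- (+ 1 / suc (toℕ i))))
         (List.allFin n))

rhs : ℕ → ℤ → ℚ
rhs n k = List.foldr ℚ._+_ 0ℚ
  (map weight (filter (λ V → oneIn? V ×-dec ((+ elemSum V) ℤ.≟ k)) (subsets n)))

lhs : ℕ → ℤ → ℚ
lhs n k = (+ 𝒞 n k) / (n ℕ.!) where
  instance _ = n !≢0

-- Both sides f(n, k) satisfy f(n+1, k) = 1/(n+1) · f(n, k−n−1) + (1 − 1/(n+1)) · f(n, k) and agree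
-- at n = 0, where the right-hand side is read as the sum over all V (for n ≥ 1 the subsets without 1
-- contribute nothing, as they carry the factor 1 − 1/1 = 0).
-- Permutations: a permutation of {1,…,n+1} is determined by its last letter v and the standardization p
-- of its first n letters. Its first n positions are records exactly when they are records of p, and
-- position n+1 is a record iff v = n+1; hence 𝒞(n+1, k) = 𝒞(n, k−n−1) + n·𝒞(n, k).
-- Subsets: splitting on whether n+1 ∈ V gives the same recursion for the weighted subset sum.

module Submission where

open import Defs
open import Data.Nat using (ℕ; _≥_)
open import Data.Integer using (ℤ)
open import Relation.Binary.PropositionalEquality using (_≡_)

open import Data.Bool using (Bool; true; false; if_then_else_)
open import Data.Empty using (⊥-elim)
open import Data.Fin as Fin using (Fin; zero; suc; toℕ; punchIn; inject₁; fromℕ; lower₁)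
import Data.Fin.Properties as FinP
open import Data.Fin.Subset using (Subset)
import Data.Integer as ℤ
import Data.Integer.Properties as ℤP
open import Data.Integer.Solver using (module +-*-Solver)
open import Data.List as List using (List; []; _∷_; map; filter; concatMap; length; allFin)
import Data.List.Properties as ListP
open import Data.List.Membership.Propositional using (_∈_; _∉_)
open import Data.List.Membership.Propositional.Properties using (∈-map⁻)
open import Data.List.Relation.Unary.Any using (here; there)
import Data.List.Relation.Unary.All as All
import Data.List.Relation.Unary.All.Properties as AllP
import Data.List.Relation.Unary.AllPairs as AllPairs
open import Data.List.Relation.Unary.Unique.Propositional using (Unique)
import Data.List.Relation.Unary.Unique.Propositional.Properties as UniqueP
open import Data.Nat as ℕ using (zero; suc; _+_; _*_; NonZero)
import Data.Nat.Properties as ℕP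
open import Data.Nat.ListAction using () renaming (sum to sumList)
import Data.Nat.ListAction.Properties as SumListP
open import Data.Product using (_×_; _,_; proj₁; proj₂; ∃)
open import Data.Rational as ℚ using (ℚ; 0ℚ; 1ℚ; toℚᵘ)
import Data.Rational.Properties as ℚP
import Data.Rational.Solver as ℚSolver
open import Data.Rational.Unnormalised as ℚᵘ using (mkℚᵘ; *≡*)
import Data.Rational.Unnormalised.Properties as ℚᵘP
open import Data.Vec as Vec using (Vec; []; _∷_; lookup; toList; _∷ʳ_)
import Data.Vec.Functional as VecF
import Data.Vec.Properties as VecP
import Data.Vec.Relation.Unary.All.Properties as VecAllP
open import Algebra.Properties.CommutativeMonoid.Sum ℕP.+-0-commutativeMonoid
  using (sum; sum-cong-≗; sum-replicate-zero; sum-remove; sum-init-last; ∑-comm)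
import Algebra.Properties.Monoid.Sum ℚP.*-1-monoid as ∏
import Algebra.Properties.AbelianGroup ℤP.+-0-abelianGroup as ℤGroup
import Algebra.Properties.AbelianGroup ℚP.+-0-abelianGroup as ℚGroup
import Algebra.Properties.CommutativeSemigroup ℤP.+-commutativeSemigroup as ℤSemigroup
open import Function using (_∘_; id; _⇔_; mk⇔; Equivalence)
open import Relation.Binary.PropositionalEquality
  using (_≢_; refl; sym; trans; cong; cong₂; subst; subst₂; module ≡-Reasoning)
open import Relation.Nullary using (Dec; yes; no; does; ¬_; _×-dec_)
open import Relation.Nullary.Decidable using (does-⇔; dec-true; dec-false)

foldr-map-allFin : ∀ {A B : Set} (_∙_ : A → B → B) (e : B) {n} (f : Fin n → A) →
                   List.foldr _∙_ e (map f (allFin n)) ≡ VecF.foldr _∙_ e f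
foldr-map-allFin _∙_ e {zero}  f = refl
foldr-map-allFin _∙_ e {suc n} f = cong (f zero ∙_) (begin
  List.foldr _∙_ e (map f (List.tabulate suc))   ≡⟨ cong (List.foldr _∙_ e) (ListP.map-tabulate suc f) ⟩
  List.foldr _∙_ e (List.tabulate (f ∘ suc))     ≡⟨ cong (List.foldr _∙_ e) (ListP.map-tabulate id (f ∘ suc)) ⟨
  List.foldr _∙_ e (map (f ∘ suc) (allFin n))    ≡⟨ foldr-map-allFin _∙_ e (f ∘ suc) ⟩
  VecF.foldr _∙_ e (f ∘ suc)                     ∎)
  where open ≡-Reasoning

sum-const : ∀ n c → sum {n} (λ _ → c) ≡ n * c
sum-const zero    c = refl
sum-const (suc n) c = cong (c +_) (sum-const n c)

sumList-concatMap : ∀ {A B : Set} (f : B → ℕ) (g : A → List B) xs →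
                    sumList (map f (concatMap g xs)) ≡ sumList (map (λ x → sumList (map f (g x))) xs)
sumList-concatMap f g []       = refl
sumList-concatMap f g (x ∷ xs) = begin
  sumList (map f (g x List.++ concatMap g xs))                  ≡⟨ cong sumList (ListP.map-++ f (g x) _) ⟩
  sumList (map f (g x) List.++ map f (concatMap g xs))          ≡⟨ SumListP.sum-++ (map f (g x)) _ ⟩
  sumList (map f (g x)) + sumList (map f (concatMap g xs))      ≡⟨ cong (_ +_) (sumList-concatMap f g xs) ⟩
  sumList (map f (g x)) + sumList (map (λ x → sumList (map f (g x))) xs) ∎
  where open ≡-Reasoning

indicator : ∀ {p} {P : Set p} → Dec P → ℕ
indicator P? = if does P? then 1 else 0

indicator-⇔ : ∀ {p q} {P : Set p} {Q : Set q} → P ⇔ Q → (P? : Dec P) (Q? : Dec Q) → indicator P? ≡ indicator Q?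
indicator-⇔ P⇔Q P? Q? = cong (λ b → if b then 1 else 0) (does-⇔ P⇔Q P? Q?)

length-filter : ∀ {A : Set} {p} {P : A → Set p} (P? : ∀ x → Dec (P x)) xs →
                length (filter P? xs) ≡ sumList (map (indicator ∘ P?) xs)
length-filter P? []       = refl
length-filter P? (x ∷ xs) with does (P? x)
... | true  = cong suc (length-filter P? xs)
... | false = length-filter P? xs

sumWords : ∀ n m → (Vec (Fin n) m → ℕ) → ℕ
sumWords n zero    f = f []
sumWords n (suc m) f = sum λ x → sumWords n m (f ∘ (x ∷_))

sumList-words : ∀ n m (f : Vec (Fin n) m → ℕ) → sumList (map f (words n m)) ≡ sumWords n m f
sumList-words n zero    f = ℕP.+-identityʳ (f [])
sumList-words n (suc m) f = begin
  sumList (map f (concatMap (λ x → map (x ∷_) (words n m)) (allFin n)))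
    ≡⟨ sumList-concatMap f _ (allFin n) ⟩
  sumList (map (λ x → sumList (map f (map (x ∷_) (words n m)))) (allFin n))
    ≡⟨ foldr-map-allFin _+_ 0 (λ x → sumList (map f (map (x ∷_) (words n m)))) ⟩
  sum (λ x → sumList (map f (map (x ∷_) (words n m))))
    ≡⟨ sum-cong-≗ (λ x → trans (cong sumList (sym (ListP.map-∘ (words n m))))
                                (sumList-words n m (f ∘ (x ∷_)))) ⟩
  sumWords n (suc m) f ∎
  where open ≡-Reasoning

sumWords-cong : ∀ n m {f g : Vec (Fin n) m → ℕ} → (∀ w → f w ≡ g w) → sumWords n m f ≡ sumWords n m g
sumWords-cong n zero    f≗g = f≗g []
sumWords-cong n (suc m) f≗g = sum-cong-≗ λ x → sumWords-cong n m (f≗g ∘ (x ∷_))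

sumWords-zero : ∀ n m → sumWords n m (λ _ → 0) ≡ 0
sumWords-zero n zero    = refl
sumWords-zero n (suc m) = trans (sum-cong-≗ {n} {y = λ _ → 0} λ _ → sumWords-zero n m)
                                (sum-replicate-zero n)

sumWords-∑-comm : ∀ n m p (f : Vec (Fin n) m → Fin p → ℕ) →
                  sumWords n m (λ w → sum (f w)) ≡ sum (λ y → sumWords n m (λ w → f w y))
sumWords-∑-comm n zero    p f = refl
sumWords-∑-comm n (suc m) p f = trans (sum-cong-≗ λ x → sumWords-∑-comm n m p (f ∘ (x ∷_)))
                                      (∑-comm λ x y → sumWords n m (λ w → f (x ∷ w) y))

sumWords-∷ʳ : ∀ n m (f : Vec (Fin n) (suc m) → ℕ) →
              sumWords n (suc m) f ≡ sumWords n m (λ w → sum λ x → f (w ∷ʳ x))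
sumWords-∷ʳ n zero    f = refl
sumWords-∷ʳ n (suc m) f = sum-cong-≗ λ x → sumWords-∷ʳ n m (f ∘ (x ∷_))

-- Words over Fin (suc n) avoiding the letter v are the images of words over Fin n under punchIn v.
sumWords-avoid : ∀ n m (v : Fin (suc n)) (g : Vec (Fin (suc n)) m → ℕ) →
                 (∀ w → v ∈ toList w → g w ≡ 0) →
                 sumWords (suc n) m g ≡ sumWords n m (g ∘ Vec.map (punchIn v))
sumWords-avoid n zero    v g g≡0 = refl
sumWords-avoid n (suc m) v g g≡0 = begin
  sum (λ x → sumWords (suc n) m (g ∘ (x ∷_)))
    ≡⟨ sum-remove {i = v} (λ x → sumWords (suc n) m (g ∘ (x ∷_))) ⟩
  sumWords (suc n) m (g ∘ (v ∷_)) + sum (λ y → sumWords (suc n) m (g ∘ (punchIn v y ∷_)))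
    ≡⟨ cong₂ _+_ (trans (sumWords-cong (suc n) m (λ w → g≡0 (v ∷ w) (here refl))) (sumWords-zero (suc n) m))
                 (sum-cong-≗ λ y → sumWords-avoid n m v (g ∘ (punchIn v y ∷_)) (λ w → g≡0 _ ∘ there)) ⟩
  sumWords n (suc m) (g ∘ Vec.map (punchIn v)) ∎
  where open ≡-Reasoning

unique-∷ʳ⁺ : ∀ {A : Set} {x : A} {xs} → Unique xs → x ∉ xs → Unique (xs List.++ List.[ x ])
unique-∷ʳ⁺ {xs = []}     _          _   = All.[] AllPairs.∷ AllPairs.[]
unique-∷ʳ⁺ {xs = y ∷ ys} (y∉ AllPairs.∷ u) x∉ =
  AllP.++⁺ y∉ ((λ y≡x → x∉ (here (sym y≡x))) All.∷ All.[]) AllPairs.∷ unique-∷ʳ⁺ u (x∉ ∘ there)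

unique-∷ʳ⁻ : ∀ {A : Set} {x : A} xs → Unique (xs List.++ List.[ x ]) → Unique xs × x ∉ xs
unique-∷ʳ⁻ []       _                 = AllPairs.[] , λ ()
unique-∷ʳ⁻ (y ∷ ys) (y∉ AllPairs.∷ u) with unique-∷ʳ⁻ ys u | AllP.++⁻ ys y∉
... | u′ , x∉ys | y∉ys , y≢x All.∷ _ = (y∉ys AllPairs.∷ u′) , λ
  { (here x≡y)   → y≢x (sym x≡y)
  ; (there x∈ys) → x∉ys x∈ys }

¬unique-∷ʳ-∈ : ∀ {A : Set} {m} {v : A} (w : Vec A m) → v ∈ toList w → ¬ Unique (toList (w ∷ʳ v))
¬unique-∷ʳ-∈ {v = v} w v∈w u =
  proj₂ (unique-∷ʳ⁻ (toList w) (subst Unique (VecP.toList-∷ʳ v w) u)) v∈w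

unique⇒lookup-injective : ∀ {A : Set} {m} (a : Vec A m) → Unique (toList a) →
                          ∀ {i j} → lookup a i ≡ lookup a j → i ≡ j
unique⇒lookup-injective (x ∷ a) _                 {zero}  {zero}  _  = refl
unique⇒lookup-injective (x ∷ a) (x∉ AllPairs.∷ _) {zero}  {suc j} eq =
  ⊥-elim (VecAllP.lookup⁺ (VecAllP.toList⁻ x∉) j eq)
unique⇒lookup-injective (x ∷ a) (x∉ AllPairs.∷ _) {suc i} {zero}  eq =
  ⊥-elim (VecAllP.lookup⁺ (VecAllP.toList⁻ x∉) i (sym eq))
unique⇒lookup-injective (x ∷ a) (_ AllPairs.∷ u)  {suc i} {suc j} eq = cong suc (unique⇒lookup-injective a u eq)

-- The pigeonhole principle, applied to f with the missed value punched out.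
injective⇒surjective : ∀ {n} (f : Fin n → Fin n) → (∀ {i j} → f i ≡ f j → i ≡ j) →
                       ∀ x → ∃ λ i → f i ≡ x
injective⇒surjective f inj x with FinP.any? (λ i → f i FinP.≟ x)
... | yes hit = hit
injective⇒surjective {suc n} f inj x | no miss =
  let i , j , i<j , eq = FinP.pigeonhole (ℕP.n<1+n n) (λ i → Fin.punchOut (x≢f i))
  in ⊥-elim (FinP.<⇒≢ i<j (inj (FinP.punchOut-injective (x≢f i) (x≢f j) eq)))
  where
  x≢f : ∀ i → x ≢ f i
  x≢f i x≡fi = miss (i , sym x≡fi)

lookup-∷ʳ-inject₁ : ∀ {A : Set} {m} (xs : Vec A m) x j → lookup (xs ∷ʳ x) (inject₁ j) ≡ lookup xs j
lookup-∷ʳ-inject₁ (y ∷ xs) x zero    = refl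
lookup-∷ʳ-inject₁ (y ∷ xs) x (suc j) = lookup-∷ʳ-inject₁ xs x j

lookup-∷ʳ-fromℕ : ∀ {A : Set} {m} (xs : Vec A m) x → lookup (xs ∷ʳ x) (fromℕ m) ≡ x
lookup-∷ʳ-fromℕ []       x = refl
lookup-∷ʳ-fromℕ (y ∷ xs) x = lookup-∷ʳ-fromℕ xs x

punchIn-mono-< : ∀ {n} (i : Fin (suc n)) {j k : Fin n} → j Fin.< k → punchIn i j Fin.< punchIn i k
punchIn-mono-< i {j} {k} j<k = FinP.≤∧≢⇒< (FinP.punchIn-mono-≤ i j k (ℕP.<⇒≤ j<k))
                                          (FinP.<⇒≢ j<k ∘ FinP.punchIn-injective i j k)

punchIn-cancel-< : ∀ {n} (i : Fin (suc n)) {j k : Fin n} → punchIn i j Fin.< punchIn i k → j Fin.< k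
punchIn-cancel-< i {j} {k} lt = FinP.≤∧≢⇒< (FinP.punchIn-cancel-≤ i j k (ℕP.<⇒≤ lt))
                                           (FinP.<⇒≢ lt ∘ cong (punchIn i))

punchIn-inject₁-self : ∀ {n} (y : Fin n) → punchIn (inject₁ y) y ≡ suc y
punchIn-inject₁-self zero    = refl
punchIn-inject₁-self (suc y) = cong suc (punchIn-inject₁-self y)

punchIn-fromℕ : ∀ {n} (x : Fin n) → punchIn (fromℕ n) x ≡ inject₁ x
punchIn-fromℕ zero    = refl
punchIn-fromℕ (suc x) = cong suc (punchIn-fromℕ x)

inject₁-preimage : ∀ {n} (i : Fin (suc n)) → toℕ i ℕ.< n → ∃ λ i' → inject₁ i' ≡ i
inject₁-preimage i i<n = lower₁ i n≢i , FinP.inject₁-lower₁ i n≢i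
  where
  n≢i : _ ≢ toℕ i
  n≢i n≡i = ℕP.<-irrefl (sym n≡i) i<n

inject₁-mono-< : ∀ {n} {i j : Fin n} → i Fin.< j → inject₁ i Fin.< inject₁ j
inject₁-mono-< {i = i} {j} = subst₂ ℕ._<_ (sym (FinP.toℕ-inject₁ i)) (sym (FinP.toℕ-inject₁ j))

inject₁<fromℕ : ∀ {n} (j : Fin n) → inject₁ j Fin.< fromℕ n
inject₁<fromℕ {n} j = subst (toℕ (inject₁ j) ℕ.<_) (sym (FinP.toℕ-fromℕ n)) (FinP.inject₁ℕ< j)

extend : ∀ {n m} → Fin (suc n) → Vec (Fin n) m → Vec (Fin (suc n)) (suc m)
extend v p = Vec.map (punchIn v) p ∷ʳ v

toList-extend : ∀ {n m} (v : Fin (suc n)) (p : Vec (Fin n) m) →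
                toList (extend v p) ≡ map (punchIn v) (toList p) List.++ List.[ v ]
toList-extend v p = trans (VecP.toList-∷ʳ v (Vec.map (punchIn v) p))
                          (cong (List._++ List.[ v ]) (VecP.toList-map (punchIn v) p))

unique-extend⁺ : ∀ {n m} (v : Fin (suc n)) (p : Vec (Fin n) m) →
                 Unique (toList p) → Unique (toList (extend v p))
unique-extend⁺ v p u = subst Unique (sym (toList-extend v p))
  (unique-∷ʳ⁺ (UniqueP.map⁺ (FinP.punchIn-injective v _ _) u) v∉)
  where
  v∉ : v ∉ map (punchIn v) (toList p)
  v∉ v∈ with ∈-map⁻ (punchIn v) v∈
  ... | x , _ , v≡ = FinP.punchInᵢ≢i v x (sym v≡)

unique-extend⁻ : ∀ {n m} (v : Fin (suc n)) (p : Vec (Fin n) m) →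
                 Unique (toList (extend v p)) → Unique (toList p)
unique-extend⁻ v p u =
  UniqueP.map⁻ (proj₁ (unique-∷ʳ⁻ (map (punchIn v) (toList p)) (subst Unique (toList-extend v p) u)))

lookup-extend-inject₁ : ∀ {n m} (v : Fin (suc n)) (p : Vec (Fin n) m) j →
                        lookup (extend v p) (inject₁ j) ≡ punchIn v (lookup p j)
lookup-extend-inject₁ v p j = trans (lookup-∷ʳ-inject₁ (Vec.map (punchIn v) p) v j) (VecP.lookup-map j (punchIn v) p)

isRecord-extend-inject₁ : ∀ {n} (v : Fin (suc n)) (p : Vec (Fin n) n) j →
                          IsRecord (extend v p) (inject₁ j) ⇔ IsRecord p j
isRecord-extend-inject₁ v p j = mk⇔ restrict extend-record
  where
  restrict : IsRecord (extend v p) (inject₁ j) → IsRecord p j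
  restrict rec i i<j = punchIn-cancel-< v (subst₂ Fin._<_ (lookup-extend-inject₁ v p i) (lookup-extend-inject₁ v p j)
                                                         (rec (inject₁ i) (inject₁-mono-< i<j)))
  extend-record : IsRecord p j → IsRecord (extend v p) (inject₁ j)
  extend-record rec i i<j with inject₁-preimage i (ℕP.<-≤-trans i<j (FinP.inject₁ℕ≤ j))
  ... | i′ , refl = subst₂ Fin._<_ (sym (lookup-extend-inject₁ v p i′)) (sym (lookup-extend-inject₁ v p j))
                      (punchIn-mono-< v (rec i′ (subst₂ ℕ._<_ (FinP.toℕ-inject₁ i′) (FinP.toℕ-inject₁ j) i<j)))

isRecord-extend-last : ∀ {n} (v : Fin (suc n)) (p : Vec (Fin n) n) →
                       IsRecord (extend v p) (fromℕ n) ⇔ (∀ j → punchIn v (lookup p j) Fin.< v)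
isRecord-extend-last {n} v p = mk⇔
  (λ rec j → subst₂ Fin._<_ (lookup-extend-inject₁ v p j) last≡v (rec (inject₁ j) (inject₁<fromℕ j)))
  (λ below i i<n → record-of-below below i (subst (toℕ i ℕ.<_) (FinP.toℕ-fromℕ n) i<n))
  where
  last≡v : lookup (extend v p) (fromℕ n) ≡ v
  last≡v = lookup-∷ʳ-fromℕ (Vec.map (punchIn v) p) v
  record-of-below : (∀ j → punchIn v (lookup p j) Fin.< v) →
                    ∀ i → toℕ i ℕ.< n → lookup (extend v p) i Fin.< lookup (extend v p) (fromℕ n)
  record-of-below below i i<n with inject₁-preimage i i<n
  ... | j , refl = subst₂ Fin._<_ (sym (lookup-extend-inject₁ v p j)) (sym last≡v) (below j)

isRecord-extend-fromℕ : ∀ {n} (p : Vec (Fin n) n) → IsRecord (extend (fromℕ n) p) (fromℕ n)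
isRecord-extend-fromℕ {n} p = Equivalence.from (isRecord-extend-last (fromℕ n) p)
  λ j → subst (Fin._< fromℕ n) (sym (punchIn-fromℕ (lookup p j))) (inject₁<fromℕ (lookup p j))

-- The letter y occurs somewhere in p, and after punching in y it becomes y + 1 > y.
¬isRecord-extend-inject₁ : ∀ {n} (y : Fin n) (p : Vec (Fin n) n) → IsPerm p →
                           ¬ IsRecord (extend (inject₁ y) p) (fromℕ n)
¬isRecord-extend-inject₁ y p perm rec with injective⇒surjective (lookup p) (unique⇒lookup-injective p perm) y
... | i , refl = ℕP.<-asym (ℕP.n<1+n (toℕ y))
                           (subst₂ ℕ._<_ (cong toℕ (punchIn-inject₁-self y)) (FinP.toℕ-inject₁ y) y+1<y)
  where
  y+1<y : punchIn (inject₁ y) y Fin.< inject₁ y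
  y+1<y = Equivalence.to (isRecord-extend-last (inject₁ y) p) rec i

recordTerm : ∀ {n} → Vec (Fin n) n → Fin n → ℕ
recordTerm a j = if does (isRecord? a j) then suc (toℕ j) else 0

recordSum≡sum : ∀ {n} (a : Vec (Fin n) n) → recordSum a ≡ sum (recordTerm a)
recordSum≡sum a = foldr-map-allFin _+_ 0 (recordTerm a)

recordSum-extend : ∀ {n} (v : Fin (suc n)) (p : Vec (Fin n) n) →
                   recordSum (extend v p) ≡ recordSum p + recordTerm (extend v p) (fromℕ n)
recordSum-extend {n} v p = begin
  recordSum (extend v p)
    ≡⟨ recordSum≡sum (extend v p) ⟩
  sum (recordTerm (extend v p))
    ≡⟨ sum-init-last (recordTerm (extend v p)) ⟩
  sum (recordTerm (extend v p) ∘ inject₁) + recordTerm (extend v p) (fromℕ n)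
    ≡⟨ cong (_+ recordTerm (extend v p) (fromℕ n)) (sum-cong-≗ initial-terms) ⟩
  sum (recordTerm p) + recordTerm (extend v p) (fromℕ n)
    ≡⟨ cong (_+ recordTerm (extend v p) (fromℕ n)) (recordSum≡sum p) ⟨
  recordSum p + recordTerm (extend v p) (fromℕ n) ∎
  where
  open ≡-Reasoning
  initial-terms : ∀ j → recordTerm (extend v p) (inject₁ j) ≡ recordTerm p j
  initial-terms j = cong₂ (λ b t → if b then suc t else 0)
    (does-⇔ (isRecord-extend-inject₁ v p j) (isRecord? (extend v p) (inject₁ j)) (isRecord? p j))
    (FinP.toℕ-inject₁ j)

recordSum-extend-fromℕ : ∀ {n} (p : Vec (Fin n) n) → recordSum (extend (fromℕ n) p) ≡ recordSum p + suc n
recordSum-extend-fromℕ {n} p = trans (recordSum-extend (fromℕ n) p) (cong (recordSum p +_) (begin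
  recordTerm (extend (fromℕ n) p) (fromℕ n)
    ≡⟨ cong (λ b → if b then suc (toℕ (fromℕ n)) else 0)
            (dec-true (isRecord? (extend (fromℕ n) p) (fromℕ n)) (isRecord-extend-fromℕ p)) ⟩
  suc (toℕ (fromℕ n))
    ≡⟨ cong suc (FinP.toℕ-fromℕ n) ⟩
  suc n ∎))
  where open ≡-Reasoning

recordSum-extend-inject₁ : ∀ {n} (y : Fin n) (p : Vec (Fin n) n) → IsPerm p →
                           recordSum (extend (inject₁ y) p) ≡ recordSum p
recordSum-extend-inject₁ {n} y p perm = begin
  recordSum (extend (inject₁ y) p)
    ≡⟨ recordSum-extend (inject₁ y) p ⟩
  recordSum p + recordTerm (extend (inject₁ y) p) (fromℕ n)
    ≡⟨ cong (λ b → recordSum p + (if b then suc (toℕ (fromℕ n)) else 0))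
            (dec-false (isRecord? (extend (inject₁ y) p) (fromℕ n)) (¬isRecord-extend-inject₁ y p perm)) ⟩
  recordSum p + 0
    ≡⟨ ℕP.+-identityʳ (recordSum p) ⟩
  recordSum p ∎
  where open ≡-Reasoning

-- Counting permutations by record sum

+-≡⇔≡- : ∀ r s k → (ℤ.+ (r + s) ≡ k) ⇔ (ℤ.+ r ≡ k ℤ.- ℤ.+ s)
+-≡⇔≡- r s k = mk⇔
  (λ eq → trans (sym (ℤGroup.//-rightDividesʳ (ℤ.+ s) (ℤ.+ r))) (cong (ℤ._- ℤ.+ s) (trans (sym (ℤP.pos-+ r s)) eq)))
  (λ eq → trans (ℤP.pos-+ r s) (trans (cong (ℤ._+ ℤ.+ s) eq) (ℤGroup.//-rightDividesˡ (ℤ.+ s) k)))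

permWithRecordSum? : ∀ {n} k (a : Vec (Fin n) n) → Dec (IsPerm a × ℤ.+ recordSum a ≡ k)
permWithRecordSum? k a = isPerm? a ×-dec (ℤ.+ recordSum a ℤ.≟ k)

𝒞≡sumWords : ∀ n k → 𝒞 n k ≡ sumWords n n (indicator ∘ permWithRecordSum? k)
𝒞≡sumWords n k = trans (length-filter (permWithRecordSum? k) (words n n)) (sumList-words n n _)

indicator-extend-fromℕ : ∀ {n} k (p : Vec (Fin n) n) →
  indicator (permWithRecordSum? k (extend (fromℕ n) p)) ≡ indicator (permWithRecordSum? (k ℤ.- ℤ.+ suc n) p)
indicator-extend-fromℕ {n} k p = indicator-⇔ (mk⇔
  (λ (perm , sum≡k) → unique-extend⁻ (fromℕ n) p perm ,
                      Equivalence.to (+-≡⇔≡- _ _ k) (trans (cong ℤ.+_ (sym (recordSum-extend-fromℕ p))) sum≡k))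
  (λ (perm , sum≡k) → unique-extend⁺ (fromℕ n) p perm ,
                      trans (cong ℤ.+_ (recordSum-extend-fromℕ p)) (Equivalence.from (+-≡⇔≡- _ _ k) sum≡k)))
  (permWithRecordSum? k (extend (fromℕ n) p)) (permWithRecordSum? (k ℤ.- ℤ.+ suc n) p)

indicator-extend-inject₁ : ∀ {n} k (y : Fin n) (p : Vec (Fin n) n) →
  indicator (permWithRecordSum? k (extend (inject₁ y) p)) ≡ indicator (permWithRecordSum? k p)
indicator-extend-inject₁ k y p = indicator-⇔ (mk⇔
  (λ (perm , sum≡k) → let perm′ = unique-extend⁻ (inject₁ y) p perm
                      in perm′ , trans (cong ℤ.+_ (sym (recordSum-extend-inject₁ y p perm′))) sum≡k)
  (λ (perm , sum≡k) → unique-extend⁺ (inject₁ y) p perm ,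
                      trans (cong ℤ.+_ (recordSum-extend-inject₁ y p perm)) sum≡k))
  (permWithRecordSum? k (extend (inject₁ y) p)) (permWithRecordSum? k p)

indicator-∷ʳ-∈ : ∀ {n} k (v : Fin (suc n)) (w : Vec (Fin (suc n)) n) → v ∈ toList w →
                 indicator (permWithRecordSum? k (w ∷ʳ v)) ≡ 0
indicator-∷ʳ-∈ k v w v∈w =
  cong (λ b → if b then 1 else 0) (dec-false (permWithRecordSum? k (w ∷ʳ v)) (¬unique-∷ʳ-∈ w v∈w ∘ proj₁))

𝒞-suc : ∀ n k → 𝒞 (suc n) k ≡ 𝒞 n (k ℤ.- ℤ.+ suc n) + n * 𝒞 n k
𝒞-suc n k = begin
  𝒞 (suc n) k
    ≡⟨ 𝒞≡sumWords (suc n) k ⟩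
  sumWords (suc n) (suc n) χ
    ≡⟨ sumWords-∷ʳ (suc n) n χ ⟩
  sumWords (suc n) n (λ w → sum λ v → χ (w ∷ʳ v))
    ≡⟨ sumWords-∑-comm (suc n) n (suc n) (λ w v → χ (w ∷ʳ v)) ⟩
  sum (λ v → sumWords (suc n) n (λ w → χ (w ∷ʳ v)))
    ≡⟨ sum-cong-≗ (λ v → sumWords-avoid n n v (λ w → χ (w ∷ʳ v)) (indicator-∷ʳ-∈ k v)) ⟩
  sum (λ v → sumWords n n (χ ∘ extend v))
    ≡⟨ sum-init-last (λ v → sumWords n n (χ ∘ extend v)) ⟩
  sum (λ y → sumWords n n (χ ∘ extend (inject₁ y))) + sumWords n n (χ ∘ extend (fromℕ n))
    ≡⟨ cong₂ _+_ smaller-last largest-last ⟩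
  n * 𝒞 n k + 𝒞 n (k ℤ.- ℤ.+ suc n)
    ≡⟨ ℕP.+-comm (n * 𝒞 n k) _ ⟩
  𝒞 n (k ℤ.- ℤ.+ suc n) + n * 𝒞 n k ∎
  where
  open ≡-Reasoning
  χ : Vec (Fin (suc n)) (suc n) → ℕ
  χ = indicator ∘ permWithRecordSum? k
  smaller-last : sum (λ y → sumWords n n (χ ∘ extend (inject₁ y))) ≡ n * 𝒞 n k
  smaller-last = begin
    sum (λ y → sumWords n n (χ ∘ extend (inject₁ y)))
      ≡⟨ sum-cong-≗ (λ y → trans (sumWords-cong n n (indicator-extend-inject₁ k y)) (sym (𝒞≡sumWords n k))) ⟩
    sum {n} (λ _ → 𝒞 n k)
      ≡⟨ sum-const n (𝒞 n k) ⟩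
    n * 𝒞 n k ∎
  largest-last : sumWords n n (χ ∘ extend (fromℕ n)) ≡ 𝒞 n (k ℤ.- ℤ.+ suc n)
  largest-last = trans (sumWords-cong n n (indicator-extend-fromℕ k)) (sym (𝒞≡sumWords n _))

1/suc : ℕ → ℚ
1/suc n = ℤ.+ 1 ℚ./ suc n

mix : ℚ → ℚ → ℚ → ℚ
mix t x y = t ℚ.* x ℚ.+ (1ℚ ℚ.- t) ℚ.* y

toℚᵘ-/ : ∀ i d → toℚᵘ (i ℚ./ suc d) ℚᵘ.≃ mkℚᵘ i d
toℚᵘ-/ i d = ℚP.toℚᵘ-fromℚᵘ (mkℚᵘ i d)

/-distribʳ-+ : ∀ a b d .{{_ : NonZero d}} → ℤ.+ (a + b) ℚ./ d ≡ ℤ.+ a ℚ./ d ℚ.+ ℤ.+ b ℚ./ d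
/-distribʳ-+ a b (suc d) = ℚP.toℚᵘ-injective (begin
  toℚᵘ (ℤ.+ (a + b) ℚ./ suc d)                                ≈⟨ toℚᵘ-/ (ℤ.+ (a + b)) d ⟩
  mkℚᵘ (ℤ.+ (a + b)) d                                        ≈⟨ *≡* eq ⟩
  mkℚᵘ (ℤ.+ a) d ℚᵘ.+ mkℚᵘ (ℤ.+ b) d                          ≈⟨ ℚᵘP.+-cong (toℚᵘ-/ (ℤ.+ a) d) (toℚᵘ-/ (ℤ.+ b) d) ⟨
  toℚᵘ (ℤ.+ a ℚ./ suc d) ℚᵘ.+ toℚᵘ (ℤ.+ b ℚ./ suc d)          ≈⟨ ℚP.toℚᵘ-homo-+ (ℤ.+ a ℚ./ suc d) _ ⟨
  toℚᵘ (ℤ.+ a ℚ./ suc d ℚ.+ ℤ.+ b ℚ./ suc d)                  ∎)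
  where
  open ℚᵘP.≃-Reasoning
  open +-*-Solver
  eq : ℤ.+ (a + b) ℤ.* ℤ.+ (suc d * suc d) ≡ (ℤ.+ a ℤ.* ℤ.+ suc d ℤ.+ ℤ.+ b ℤ.* ℤ.+ suc d) ℤ.* ℤ.+ suc d
  eq = trans (cong₂ ℤ._*_ (ℤP.pos-+ a b) (ℤP.pos-* (suc d) (suc d)))
             (solve 3 (λ x y z → (x :+ y) :* (z :* z) := (x :* z :+ y :* z) :* z) refl (ℤ.+ a) (ℤ.+ b) (ℤ.+ suc d))

/-distrib-* : ∀ a b m d .{{_ : NonZero m}} .{{_ : NonZero d}} .{{_ : NonZero (m * d)}} →
              ℤ.+ (a * b) ℚ./ (m * d) ≡ (ℤ.+ a ℚ./ m) ℚ.* (ℤ.+ b ℚ./ d)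
/-distrib-* a b (suc m) (suc d) = ℚP.toℚᵘ-injective (begin
  toℚᵘ (ℤ.+ (a * b) ℚ./ (suc m * suc d))                     ≈⟨ toℚᵘ-/ (ℤ.+ (a * b)) (d + m * suc d) ⟩
  mkℚᵘ (ℤ.+ (a * b)) (d + m * suc d)                         ≈⟨ ℚᵘP.≃-reflexive (cong (λ i → mkℚᵘ i (d + m * suc d)) (ℤP.pos-* a b)) ⟩
  mkℚᵘ (ℤ.+ a) m ℚᵘ.* mkℚᵘ (ℤ.+ b) d                         ≈⟨ ℚᵘP.*-cong (toℚᵘ-/ (ℤ.+ a) m) (toℚᵘ-/ (ℤ.+ b) d) ⟨
  toℚᵘ (ℤ.+ a ℚ./ suc m) ℚᵘ.* toℚᵘ (ℤ.+ b ℚ./ suc d)         ≈⟨ ℚP.toℚᵘ-homo-* (ℤ.+ a ℚ./ suc m) _ ⟨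
  toℚᵘ ((ℤ.+ a ℚ./ suc m) ℚ.* (ℤ.+ b ℚ./ suc d))             ∎)
  where open ℚᵘP.≃-Reasoning

n/n≡1 : ∀ n → ℤ.+ suc n ℚ./ suc n ≡ 1ℚ
n/n≡1 n = ℚP.toℚᵘ-injective (ℚᵘP.≃-trans (toℚᵘ-/ (ℤ.+ suc n) n) (*≡* (ℤP.*-comm (ℤ.+ suc n) (ℤ.+ 1))))

1-1/suc : ∀ n → 1ℚ ℚ.- 1/suc n ≡ ℤ.+ n ℚ./ suc n
1-1/suc n = begin
  1ℚ ℚ.- 1/suc n                                       ≡⟨ cong (ℚ._- 1/suc n) (n/n≡1 n) ⟨
  ℤ.+ (1 + n) ℚ./ suc n ℚ.- 1/suc n                    ≡⟨ cong (ℚ._- 1/suc n) (/-distribʳ-+ 1 n (suc n)) ⟩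
  1/suc n ℚ.+ ℤ.+ n ℚ./ suc n ℚ.- 1/suc n              ≡⟨ ℚGroup.xyx⁻¹≈y (1/suc n) (ℤ.+ n ℚ./ suc n) ⟩
  ℤ.+ n ℚ./ suc n                                      ∎
  where open ≡-Reasoning

/-split : ∀ x y n d .{{_ : NonZero d}} .{{_ : NonZero (suc n * d)}} →
          ℤ.+ (x + n * y) ℚ./ (suc n * d) ≡ mix (1/suc n) (ℤ.+ x ℚ./ d) (ℤ.+ y ℚ./ d)
/-split x y n (suc d) = begin
  ℤ.+ (x + n * y) ℚ./ (suc n * suc d)
    ≡⟨ cong (λ i → ℤ.+ i ℚ./ (suc n * suc d)) (ℕP.*-identityˡ (x + n * y)) ⟨
  ℤ.+ (1 * (x + n * y)) ℚ./ (suc n * suc d)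
    ≡⟨ /-distrib-* 1 (x + n * y) (suc n) (suc d) ⟩
  1/suc n ℚ.* (ℤ.+ (x + n * y) ℚ./ suc d)
    ≡⟨ cong (1/suc n ℚ.*_) (/-distribʳ-+ x (n * y) (suc d)) ⟩
  1/suc n ℚ.* (X ℚ.+ ℤ.+ (n * y) ℚ./ suc d)
    ≡⟨ cong (λ z → 1/suc n ℚ.* (X ℚ.+ z)) ny/d ⟩
  1/suc n ℚ.* (X ℚ.+ (ℤ.+ n ℚ./ 1) ℚ.* Y)
    ≡⟨ distrib (1/suc n) X (ℤ.+ n ℚ./ 1) Y ⟩
  1/suc n ℚ.* X ℚ.+ (1/suc n ℚ.* (ℤ.+ n ℚ./ 1)) ℚ.* Y
    ≡⟨ cong (λ c → 1/suc n ℚ.* X ℚ.+ c ℚ.* Y) n/suc ⟩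
  mix (1/suc n) X Y ∎
  where
  open ≡-Reasoning
  X = ℤ.+ x ℚ./ suc d
  Y = ℤ.+ y ℚ./ suc d
  ny/d : ℤ.+ (n * y) ℚ./ suc d ≡ (ℤ.+ n ℚ./ 1) ℚ.* Y
  ny/d = trans (cong (λ m → ℤ.+ (n * y) ℚ./ suc m) (sym (ℕP.+-identityʳ d))) (/-distrib-* n y 1 (suc d))
  distrib : ∀ c a m b → c ℚ.* (a ℚ.+ m ℚ.* b) ≡ c ℚ.* a ℚ.+ (c ℚ.* m) ℚ.* b
  distrib = solve 4 (λ c a m b → c :* (a :+ m :* b) := c :* a :+ (c :* m) :* b) refl
    where open ℚSolver.+-*-Solver
  n/suc : 1/suc n ℚ.* (ℤ.+ n ℚ./ 1) ≡ 1ℚ ℚ.- 1/suc n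
  n/suc = begin
    1/suc n ℚ.* (ℤ.+ n ℚ./ 1)        ≡⟨ /-distrib-* 1 n (suc n) 1 ⟨
    ℤ.+ (1 * n) ℚ./ (suc n * 1)      ≡⟨ cong₂ (λ i m → ℤ.+ i ℚ./ suc m) (ℕP.*-identityˡ n) (ℕP.*-identityʳ n) ⟩
    ℤ.+ n ℚ./ suc n                  ≡⟨ 1-1/suc n ⟨
    1ℚ ℚ.- 1/suc n                   ∎

lhs-suc : ∀ n k → lhs (suc n) k ≡ mix (1/suc n) (lhs n (k ℤ.- ℤ.+ suc n)) (lhs n k)
lhs-suc n k = trans (cong (λ c → ℤ.+ c ℚ./ (suc n ℕ.!)) (𝒞-suc n k))
                    (/-split (𝒞 n (k ℤ.- ℤ.+ suc n)) (𝒞 n k) n (n ℕ.!))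
  where instance
    _ = n ℕP.!≢0
    _ = suc n ℕP.!≢0

-- Weighted subset sums

sumℚ : List ℚ → ℚ
sumℚ = List.foldr ℚ._+_ 0ℚ

sumℚ-++ : ∀ xs ys → sumℚ (xs List.++ ys) ≡ sumℚ xs ℚ.+ sumℚ ys
sumℚ-++ []       ys = sym (ℚP.+-identityˡ (sumℚ ys))
sumℚ-++ (x ∷ xs) ys = trans (cong (x ℚ.+_) (sumℚ-++ xs ys)) (sym (ℚP.+-assoc x (sumℚ xs) (sumℚ ys)))

sumℚ-*ˡ : ∀ {A : Set} c (f : A → ℚ) xs → sumℚ (map (λ x → c ℚ.* f x) xs) ≡ c ℚ.* sumℚ (map f xs)
sumℚ-*ˡ c f []       = sym (ℚP.*-zeroʳ c)
sumℚ-*ˡ c f (x ∷ xs) = trans (cong (c ℚ.* f x ℚ.+_) (sumℚ-*ˡ c f xs)) (sym (ℚP.*-distribˡ-+ c (f x) _))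

sumℚ-zero : ∀ {A : Set} (xs : List A) → sumℚ (map (λ _ → 0ℚ) xs) ≡ 0ℚ
sumℚ-zero []       = refl
sumℚ-zero (x ∷ xs) = trans (ℚP.+-identityˡ _) (sumℚ-zero xs)

sumℚ-subsets-suc : ∀ n (f : Subset (suc n) → ℚ) →
                   sumℚ (map f (subsets (suc n)))
                   ≡ sumℚ (map (f ∘ (true ∷_)) (subsets n)) ℚ.+ sumℚ (map (f ∘ (false ∷_)) (subsets n))
sumℚ-subsets-suc n f = begin
  sumℚ (map f (map (true ∷_) S List.++ map (false ∷_) S List.++ []))
    ≡⟨ cong sumℚ (ListP.map-++ f (map (true ∷_) S) _) ⟩
  sumℚ (map f (map (true ∷_) S) List.++ map f (map (false ∷_) S List.++ []))
    ≡⟨ sumℚ-++ (map f (map (true ∷_) S)) _ ⟩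
  sumℚ (map f (map (true ∷_) S)) ℚ.+ sumℚ (map f (map (false ∷_) S List.++ []))
    ≡⟨ cong₂ ℚ._+_ (cong sumℚ (sym (ListP.map-∘ S)))
                   (cong sumℚ (trans (cong (map f) (ListP.++-identityʳ _)) (sym (ListP.map-∘ S)))) ⟩
  sumℚ (map (f ∘ (true ∷_)) S) ℚ.+ sumℚ (map (f ∘ (false ∷_)) S) ∎
  where
  open ≡-Reasoning
  S = subsets n

onlyIf : ∀ {p} {P : Set p} → Dec P → ℚ → ℚ
onlyIf P? x = if does P? then x else 0ℚ

onlyIf-⇔ : ∀ {p q} {P : Set p} {Q : Set q} → P ⇔ Q → (P? : Dec P) (Q? : Dec Q) → ∀ x → onlyIf P? x ≡ onlyIf Q? x
onlyIf-⇔ P⇔Q P? Q? x = cong (λ b → if b then x else 0ℚ) (does-⇔ P⇔Q P? Q?)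

onlyIf-*ˡ : ∀ {p} {P : Set p} (P? : Dec P) c x → onlyIf P? (c ℚ.* x) ≡ c ℚ.* onlyIf P? x
onlyIf-*ˡ P? c x with does P?
... | true  = refl
... | false = sym (ℚP.*-zeroʳ c)

sumℚ-filter : ∀ {A : Set} {p} {P : A → Set p} (P? : ∀ x → Dec (P x)) (w : A → ℚ) xs →
              sumℚ (map w (filter P? xs)) ≡ sumℚ (map (λ x → onlyIf (P? x) (w x)) xs)
sumℚ-filter P? w []       = refl
sumℚ-filter P? w (x ∷ xs) with does (P? x)
... | true  = cong (w x ℚ.+_) (sumℚ-filter P? w xs)
... | false = trans (sumℚ-filter P? w xs) (sym (ℚP.+-identityˡ _))

-- The label ℓ i of an index i stands for the element ℓ i + 1; `rhs` uses the labelling toℕ.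
factor : ℕ → Bool → ℚ
factor m b = if b then 1/suc m else 1ℚ ℚ.- 1/suc m

elemSumBy : ∀ {n} → (Fin n → ℕ) → Subset n → ℕ
elemSumBy ℓ V = sum λ i → if lookup V i then suc (ℓ i) else 0

weightBy : ∀ {n} → (Fin n → ℕ) → Subset n → ℚ
weightBy ℓ V = ∏.sum λ i → factor (ℓ i) (lookup V i)

weightIf : ∀ {n} → (Fin n → ℕ) → ℤ → Subset n → ℚ
weightIf ℓ k V = onlyIf (ℤ.+ elemSumBy ℓ V ℤ.≟ k) (weightBy ℓ V)

weightSum : ∀ {n} → (Fin n → ℕ) → ℤ → ℚ
weightSum {n} ℓ k = sumℚ (map (weightIf ℓ k) (subsets n))

weightSum-cong : ∀ {n} {ℓ ℓ′ : Fin n → ℕ} → (∀ i → ℓ i ≡ ℓ′ i) → ∀ k → weightSum ℓ k ≡ weightSum ℓ′ k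
weightSum-cong {n} ℓ≗ℓ′ k = cong sumℚ (ListP.map-cong (λ V → cong₂ (λ e w → onlyIf (ℤ.+ e ℤ.≟ k) w)
  (sum-cong-≗ λ i → cong (λ t → if lookup V i then suc t else 0) (ℓ≗ℓ′ i))
  (∏.sum-cong-≗ λ i → cong (λ t → factor t (lookup V i)) (ℓ≗ℓ′ i))) (subsets n))

weightIf-true : ∀ {n} (ℓ : Fin (suc n) → ℕ) k V →
  weightIf ℓ k (true ∷ V) ≡ 1/suc (ℓ zero) ℚ.* weightIf (ℓ ∘ suc) (k ℤ.- ℤ.+ suc (ℓ zero)) V
weightIf-true ℓ k V = trans
  (onlyIf-⇔ shift (ℤ.+ elemSumBy ℓ (true ∷ V) ℤ.≟ k) (ℤ.+ e ℤ.≟ k ℤ.- ℤ.+ suc (ℓ zero)) _)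
  (onlyIf-*ˡ (ℤ.+ e ℤ.≟ k ℤ.- ℤ.+ suc (ℓ zero)) (1/suc (ℓ zero)) (weightBy (ℓ ∘ suc) V))
  where
  e = elemSumBy (ℓ ∘ suc) V
  shift : (ℤ.+ (suc (ℓ zero) + e) ≡ k) ⇔ (ℤ.+ e ≡ k ℤ.- ℤ.+ suc (ℓ zero))
  shift = subst (λ m → (ℤ.+ m ≡ k) ⇔ (ℤ.+ e ≡ k ℤ.- ℤ.+ suc (ℓ zero)))
                (ℕP.+-comm e (suc (ℓ zero))) (+-≡⇔≡- e (suc (ℓ zero)) k)

weightIf-false : ∀ {n} (ℓ : Fin (suc n) → ℕ) k V →
  weightIf ℓ k (false ∷ V) ≡ (1ℚ ℚ.- 1/suc (ℓ zero)) ℚ.* weightIf (ℓ ∘ suc) k V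
weightIf-false ℓ k V =
  onlyIf-*ˡ (ℤ.+ elemSumBy (ℓ ∘ suc) V ℤ.≟ k) (1ℚ ℚ.- 1/suc (ℓ zero)) (weightBy (ℓ ∘ suc) V)

weightSum-head : ∀ {n} (ℓ : Fin (suc n) → ℕ) k →
  weightSum ℓ k ≡ mix (1/suc (ℓ zero)) (weightSum (ℓ ∘ suc) (k ℤ.- ℤ.+ suc (ℓ zero))) (weightSum (ℓ ∘ suc) k)
weightSum-head {n} ℓ k = trans (sumℚ-subsets-suc n (weightIf ℓ k)) (cong₂ ℚ._+_
  (trans (cong sumℚ (ListP.map-cong (weightIf-true ℓ k) (subsets n)))
         (sumℚ-*ˡ (1/suc (ℓ zero)) (weightIf (ℓ ∘ suc) (k ℤ.- ℤ.+ suc (ℓ zero))) (subsets n)))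
  (trans (cong sumℚ (ListP.map-cong (weightIf-false ℓ k) (subsets n)))
         (sumℚ-*ˡ (1ℚ ℚ.- 1/suc (ℓ zero)) (weightIf (ℓ ∘ suc) k) (subsets n))))

-- Removing the largest element commutes with removing the smallest one.
weightSum-last : ∀ {n} (ℓ : Fin (suc n) → ℕ) k →
  weightSum ℓ k ≡ mix (1/suc (ℓ (fromℕ n))) (weightSum (ℓ ∘ inject₁) (k ℤ.- ℤ.+ suc (ℓ (fromℕ n))))
                      (weightSum (ℓ ∘ inject₁) k)
weightSum-last {zero}  ℓ k = weightSum-head ℓ k
weightSum-last {suc n} ℓ k = begin
  weightSum ℓ k
    ≡⟨ weightSum-head ℓ k ⟩
  mix q (W′ (k ℤ.- a)) (W′ k)
    ≡⟨ cong₂ (mix q) (weightSum-last (ℓ ∘ suc) (k ℤ.- a)) (weightSum-last (ℓ ∘ suc) k) ⟩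
  mix q (mix c (W″ (k ℤ.- a ℤ.- b)) (W″ (k ℤ.- a))) (mix c (W″ (k ℤ.- b)) (W″ k))
    ≡⟨ interchange q c _ _ _ _ ⟩
  mix c (mix q (W″ (k ℤ.- a ℤ.- b)) (W″ (k ℤ.- b))) (mix q (W″ (k ℤ.- a)) (W″ k))
    ≡⟨ cong (λ j → mix c (mix q (W″ j) (W″ (k ℤ.- b))) (mix q (W″ (k ℤ.- a)) (W″ k)))
            (ℤSemigroup.xy∙z≈xz∙y k (ℤ.- a) (ℤ.- b)) ⟩
  mix c (mix q (W″ (k ℤ.- b ℤ.- a)) (W″ (k ℤ.- b))) (mix q (W″ (k ℤ.- a)) (W″ k))
    ≡⟨ cong₂ (mix c) (weightSum-head (ℓ ∘ inject₁) (k ℤ.- b)) (weightSum-head (ℓ ∘ inject₁) k) ⟨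
  mix c (weightSum (ℓ ∘ inject₁) (k ℤ.- b)) (weightSum (ℓ ∘ inject₁) k) ∎
  where
  open ≡-Reasoning
  q = 1/suc (ℓ zero)
  c = 1/suc (ℓ (fromℕ (suc n)))
  a = ℤ.+ suc (ℓ zero)
  b = ℤ.+ suc (ℓ (fromℕ (suc n)))
  W′ = weightSum (ℓ ∘ suc)
  W″ = weightSum (ℓ ∘ suc ∘ inject₁)
  interchange : ∀ q c x y z w → mix q (mix c x y) (mix c z w) ≡ mix c (mix q x z) (mix q y w)
  interchange = solve 6 (λ q c x y z w →
      q :* (c :* x :+ (con 1ℚ :- c) :* y) :+ (con 1ℚ :- q) :* (c :* z :+ (con 1ℚ :- c) :* w)
    := c :* (q :* x :+ (con 1ℚ :- q) :* z) :+ (con 1ℚ :- c) :* (q :* y :+ (con 1ℚ :- q) :* w)) refl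
    where open ℚSolver.+-*-Solver

-- The two sides as weighted subset sums

lhs-zero : ∀ k → lhs 0 k ≡ weightSum (toℕ {0}) k
lhs-zero (ℤ.+ zero)    = refl
lhs-zero (ℤ.+ suc m)   = refl
lhs-zero ℤ.-[1+ m ]    = refl

lhs≡weightSum : ∀ n k → lhs n k ≡ weightSum (toℕ {n}) k
lhs≡weightSum zero    k = lhs-zero k
lhs≡weightSum (suc n) k = begin
  lhs (suc n) k
    ≡⟨ lhs-suc n k ⟩
  mix (1/suc n) (lhs n (k ℤ.- ℤ.+ suc n)) (lhs n k)
    ≡⟨ cong₂ (mix (1/suc n)) (lhs≡W (k ℤ.- ℤ.+ suc n)) (lhs≡W k) ⟩
  mix (1/suc n) (W (k ℤ.- ℤ.+ suc n)) (W k)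
    ≡⟨ cong (λ m → mix (1/suc m) (W (k ℤ.- ℤ.+ suc m)) (W k)) (FinP.toℕ-fromℕ n) ⟨
  mix (1/suc (toℕ (fromℕ n))) (W (k ℤ.- ℤ.+ suc (toℕ (fromℕ n)))) (W k)
    ≡⟨ weightSum-last (toℕ {suc n}) k ⟨
  weightSum (toℕ {suc n}) k ∎
  where
  open ≡-Reasoning
  W = weightSum (toℕ ∘ inject₁ {n})
  lhs≡W : ∀ j → lhs n j ≡ W j
  lhs≡W j = trans (lhs≡weightSum n j) (weightSum-cong {n} {toℕ} {toℕ ∘ inject₁} (sym ∘ FinP.toℕ-inject₁) j)

elemSum≡elemSumBy : ∀ {n} (V : Subset n) → elemSum V ≡ elemSumBy toℕ V
elemSum≡elemSumBy V = foldr-map-allFin _+_ 0 (λ i → if lookup V i then suc (toℕ i) else 0)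

weight≡weightBy : ∀ {n} (V : Subset n) → weight V ≡ weightBy toℕ V
weight≡weightBy V = foldr-map-allFin ℚ._*_ 1ℚ (λ i → factor (toℕ i) (lookup V i))

rhs≡weightSum : ∀ n k → rhs (suc n) k ≡ weightSum (toℕ {suc n}) k
rhs≡weightSum n k = begin
  rhs (suc n) k
    ≡⟨ sumℚ-filter P? weight (subsets (suc n)) ⟩
  sumℚ (map g (subsets (suc n)))
    ≡⟨ sumℚ-subsets-suc n g ⟩
  sumℚ (map (g ∘ (true ∷_)) S) ℚ.+ sumℚ (map (g ∘ (false ∷_)) S)
    ≡⟨ cong₂ ℚ._+_ (cong sumℚ (ListP.map-cong g-true S)) (sumℚ-zero S) ⟩
  sumℚ (map (weightIf ι k ∘ (true ∷_)) S) ℚ.+ 0ℚ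
    ≡⟨ cong (sumℚ (map (weightIf ι k ∘ (true ∷_)) S) ℚ.+_) without1 ⟨
  sumℚ (map (weightIf ι k ∘ (true ∷_)) S) ℚ.+ sumℚ (map (weightIf ι k ∘ (false ∷_)) S)
    ≡⟨ sumℚ-subsets-suc n (weightIf ι k) ⟨
  weightSum ι k ∎
  where
  open ≡-Reasoning
  S = subsets n
  ι = toℕ {suc n}
  P? : (V : Subset (suc n)) → Dec (OneIn V × ℤ.+ elemSum V ≡ k)
  P? V = oneIn? V ×-dec (ℤ.+ elemSum V ℤ.≟ k)
  -- g (false ∷ V) computes to 0ℚ, since oneIn? rejects V.
  g : Subset (suc n) → ℚ
  g V = onlyIf (P? V) (weight V)
  g-true : ∀ V → g (true ∷ V) ≡ weightIf ι k (true ∷ V)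
  g-true V = trans
    (onlyIf-⇔ (mk⇔ (λ (_ , eq) → trans (cong ℤ.+_ (sym (elemSum≡elemSumBy (true ∷ V)))) eq)
                   (λ eq → refl , trans (cong ℤ.+_ (elemSum≡elemSumBy (true ∷ V))) eq))
              (P? (true ∷ V)) (ℤ.+ elemSumBy ι (true ∷ V) ℤ.≟ k) (weight (true ∷ V)))
    (cong (onlyIf (ℤ.+ elemSumBy ι (true ∷ V) ℤ.≟ k)) (weight≡weightBy (true ∷ V)))
  without1 : sumℚ (map (weightIf ι k ∘ (false ∷_)) S) ≡ 0ℚ
  without1 = begin
    sumℚ (map (weightIf ι k ∘ (false ∷_)) S)            ≡⟨ cong sumℚ (ListP.map-cong (weightIf-false ι k) S) ⟩
    sumℚ (map (λ V → 0ℚ ℚ.* weightIf (ι ∘ suc) k V) S)  ≡⟨ sumℚ-*ˡ 0ℚ (weightIf (ι ∘ suc) k) S ⟩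
    0ℚ ℚ.* weightSum (ι ∘ suc) k                        ≡⟨ ℚP.*-zeroˡ (weightSum (ι ∘ suc) k) ⟩
    0ℚ                                                     ∎

lemma4p2 : (n : ℕ) → n ≥ 1 → (k : ℤ) → lhs n k ≡ rhs n k
lemma4p2 (suc n) _ k = trans (lhs≡weightSum (suc n) k) (sym (rhs≡weightSum n k))
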